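{- Let $(\mathbb{A},D)$ be an ultra-designated $\mathsf{Cobounded}$-algebra. Then (i) for all $u,v\in\mathbf{V}^{(\mathbb{A})}$, if $\mathbf{V}^{(\mathbb{A})}/\!\sim\ \not\models[u]\in[v]$ then $\mathbf{V}^{(\mathbb{A})}/\!\sim\ \models[u]\notin[v]$; (ii) if $D\setminus\{\mathbf{1}\}\neq\varnothing$, then there exist $u,v\in\mathbf{V}^{(\mathbb{A})}$ such that both $\mathbf{V}^{(\mathbb{A})}/\!\sim\ \models[u]\in[v]$ and $\mathbf{V}^{(\mathbb{A})}/\!\sim\ \models[u]\notin[v]$.
   Context: A designated set is a lattice filter $D$ with $\mathbf{1}\in D$, $\mathbf{0}\notin D$. A $\mathsf{Cobounded}$-algebra is $\langle\mathbf{A},\wedge,\vee,\Rightarrow,\mathbf{1},\mathbf{0}\rangle$ with complete distributive lattice reduct, such that $\bigvee_i a_i=\mathbf{1}$ implies some $a_j=\mathbf{1}$, $\bigwedge_i a_i=\mathbf{0}$ implies some $a_j=\mathbf{0}$, and $a\Rightarrow b=\mathbf{0}$ if $a\ne\mathbf{0},b=\mathbf{0}$, else $\mathbf{1}$. A designated $\mathsf{Cobounded}$-algebra $(\mathbb{A},D)$ adds ${}^*$: $a^*=\mathbf{0}$ if $a=\mathbf{1}$, $a^*=a$ if $a\in D\setminus\{\mathbf{1}\}$, $a^*=\mathbf{1}$ if $a\notin D$; ultra-designated if $D$ is an ultrafilter. $\mathbf{V}^{(\mathbb{A})}$ = class of $\mathbf{A}$-valued functions defined by recursion ($\mathbf{V}^{(\mathbb{A})}_\alpha$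 = functions with range in $\mathbf{A}$ and domain $\subseteq\mathbf{V}^{(\mathbb{A})}_\xi$, $\xi<\alpha$). $\llbracket\cdot\rrbracket$ denotes $\llbracket\cdot\rrbracket_{\mathrm{PA}}$: $\llbracket u\in v\rrbracket=\bigvee_{x\in\mathrm{dom}(v)}(v(x)\wedge\llbracket x=u\rrbracket)$, $\llbracket u=v\rrbracket=\bigwedge_{x\in\mathrm{dom}(u)}((u(x)\Rightarrow\llbracket x\in v\rrbracket)\wedge(\llbracket x\in v\rrbracket^*\Rightarrow u(x)^*))\wedge\bigwedge_{y\in\mathrm{dom}(v)}((v(y)\Rightarrow\llbracket y\in u\rrbracket)\wedge(\llbracket y\in u\rrbracket^*\Rightarrow v(y)^*))$, extended homomorphically (connectives to $\wedge,\vee,\Rightarrow,{}^*$, quantifiers to $\bigwedge,\bigvee$ over $\mathbf{V}^{(\mathbb{A})}$). $\mathbf{V}^{(\mathbb{A})}\models\varphi$ iff $\llbracket\varphi\rrbracket\in D$. $u\sim v$ iff $\mathbf{V}^{(\mathbb{A})}\models u=v$; $[u]$ is the class of $u$. For $\varphi(x_1,\dots,x_n)$ in $\mathcal{L}_\in$, $\mathbf{V}^{(\mathbb{A})}/\!\sim\ \models\varphi([u_1],\dots,[u_n])$ iff $\mathbf{V}^{(\mathbb{A})}\models\varphi(u_1,\dots,u_n)$. $[u]\notin[v]$ abbreviates $\neg(x\in y)$ evaluated at $([u],[v])$. -}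

module Defs where

open import Level using (Level; 0ℓ) renaming (suc to lsuc)
open import Data.Product using (Σ; ∃; _×_; _,_)
open import Data.Empty using (⊥)
open import Relation.Nullary using (¬_)
open import Relation.Binary.PropositionalEquality using (_≡_; _≢_)
open import Algebra.Lattice.Structures using (IsDistributiveLattice)

record CoboundedAlgebra : Set₁ where
  infixr 7 _∧_
  infixr 6 _∨_
  infixr 5 _⇒_
  field
    Carrier : Set
    _∧_ _∨_ _⇒_ : Carrier → Carrier → Carrier
    𝟏 𝟎 : Carrier
    ⋁ ⋀ : {I : Set} → (I → Carrier) → Carrier

  _≤_ : Carrier → Carrier → Set
  a ≤ b = a ∧ b ≡ a

  field
    isDistributiveLattice : IsDistributiveLattice _≡_ _∨_ _∧_
    𝟎-least : ∀ a → 𝟎 ≤ a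
    𝟏-greatest : ∀ a → a ≤ 𝟏
    ⋁-upper : ∀ {I} (f : I → Carrier) (i : I) → f i ≤ ⋁ f
    ⋁-least : ∀ {I} (f : I → Carrier) (b : Carrier) → (∀ i → f i ≤ b) → ⋁ f ≤ b
    ⋀-lower : ∀ {I} (f : I → Carrier) (i : I) → ⋀ f ≤ f i
    ⋀-greatest : ∀ {I} (f : I → Carrier) (b : Carrier) → (∀ i → b ≤ f i) → b ≤ ⋀ f
    ⋁-cobounded : ∀ {I} (f : I → Carrier) → ⋁ f ≡ 𝟏 → ∃ λ j → f j ≡ 𝟏
    ⋀-cobounded : ∀ {I} (f : I → Carrier) → ⋀ f ≡ 𝟎 → ∃ λ j → f j ≡ 𝟎
    ⇒-zero : ∀ a b → a ≢ 𝟎 → b ≡ 𝟎 → a ⇒ b ≡ 𝟎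
    ⇒-one-l : ∀ a b → a ≡ 𝟎 → a ⇒ b ≡ 𝟏
    ⇒-one-r : ∀ a b → b ≢ 𝟎 → a ⇒ b ≡ 𝟏

record IsDesignated (𝔸 : CoboundedAlgebra) (D : CoboundedAlgebra.Carrier 𝔸 → Set) : Set where
  open CoboundedAlgebra 𝔸
  field
    up-closed : ∀ a b → D a → a ≤ b → D b
    ∧-closed : ∀ a b → D a → D b → D (a ∧ b)
    𝟏∈D : D 𝟏
    𝟎∉D : ¬ D 𝟎

record IsUltraDesignated (𝔸 : CoboundedAlgebra) (D : CoboundedAlgebra.Carrier 𝔸 → Set) : Set₁ where
  field
    designated : IsDesignated 𝔸 D
    maximal : (F : CoboundedAlgebra.Carrier 𝔸 → Set) → IsDesignated 𝔸 F →
              (∀ a → D a → F a) → ∀ a → F a → D a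

record DesignatedCobounded : Set₁ where
  field
    algebra : CoboundedAlgebra
  open CoboundedAlgebra algebra public
  field
    D : Carrier → Set
    _* : Carrier → Carrier
    *-one : ∀ a → a ≡ 𝟏 → a * ≡ 𝟎
    *-mid : ∀ a → D a → a ≢ 𝟏 → a * ≡ a
    *-out : ∀ a → ¬ D a → a * ≡ 𝟏

record UltraDesignatedCobounded : Set₁ where
  field
    dc : DesignatedCobounded
  open DesignatedCobounded dc public
  field
    ultra : IsUltraDesignated algebra D

-- The universe V^(A): A-valued functions on sets of earlier names,
-- represented as families indexed by a small type I.
data V (A : Set) : Set₁ where
  mk : (I : Set) → (I → V A) → (I → A) → V A

dom : ∀ {A} → V A → Set
dom (mk I _ _) = I

elt : ∀ {A} (u : V A) → dom u → V A
elt (mk _ f _) = f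

val : ∀ {A} (u : V A) → dom u → A
val (mk _ _ a) = a

module Semantics (𝔸 : DesignatedCobounded) where
  open DesignatedCobounded 𝔸

  -- ⟦u = v⟧ (with ⟦x ∈ v⟧ unfolded inline for termination checking)
  ⟦_≐_⟧ : V Carrier → V Carrier → Carrier
  ⟦ mk I f a ≐ mk J g b ⟧ =
    ⋀ (λ (i : I) →
         (a i ⇒ ⋁ (λ (j : J) → b j ∧ ⟦ g j ≐ f i ⟧))
       ∧ ((⋁ (λ (j : J) → b j ∧ ⟦ g j ≐ f i ⟧)) * ⇒ (a i) *))
    ∧ ⋀ (λ (j : J) →
         (b j ⇒ ⋁ (λ (i : I) → a i ∧ ⟦ f i ≐ g j ⟧))
       ∧ ((⋁ (λ (i : I) → a i ∧ ⟦ f i ≐ g j ⟧)) * ⇒ (b j) *))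

  ⟦_∈_⟧ : V Carrier → V Carrier → Carrier
  ⟦ u ∈ mk J g b ⟧ = ⋁ (λ (j : J) → b j ∧ ⟦ g j ≐ u ⟧)

  ⊨_ : Carrier → Set
  ⊨ a = D a

  ⟦_∉_⟧ : V Carrier → V Carrier → Carrier
  ⟦ u ∉ v ⟧ = ⟦ u ∈ v ⟧ *

{-# OPTIONS --safe #-}
-- Negation is interpreted by *, which sends every undesignated value to 𝟏; hence a
-- membership that fails to hold has a designated negation. Conversely * fixes the
-- designated values other than 𝟏: if d is one of them, the name ⁅ ∅ ↦ d ⁆ (containing
-- ∅ to degree d) gives ⟦ ∅ ∈ ⁅ ∅ ↦ d ⁆ ⟧ = d = d *, so both the membership and its
-- negation are designated. Neither part needs D to be an ultrafilter.
module Submission where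

open import Defs
open import Data.Empty using (⊥)
open import Data.Unit using (⊤; tt)
open import Data.Product using (∃; _×_; _,_)
open import Relation.Nullary using (¬_)
open import Relation.Binary.PropositionalEquality
  using (_≡_; _≢_; sym; trans; cong; cong₂; subst; module ≡-Reasoning)
open import Algebra.Lattice.Bundles using (Lattice)
open import Algebra.Lattice.Structures using (IsDistributiveLattice)
import Algebra.Lattice.Properties.Lattice as LatticeProperties

module CoboundedProperties (𝔸 : CoboundedAlgebra) where
  open CoboundedAlgebra 𝔸
  open IsDistributiveLattice isDistributiveLattice using (∧-comm; isLattice)

  lattice : Lattice _ _
  lattice = record { isLattice = isLattice }

  open LatticeProperties lattice using (∧-idem)

  ≤-refl : ∀ a → a ≤ a
  ≤-refl = ∧-idem

  ≤-antisym : ∀ {a b} → a ≤ b → b ≤ a → a ≡ b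
  ≤-antisym {a} {b} a≤b b≤a = trans (sym a≤b) (trans (∧-comm a b) b≤a)

  ∧-identityʳ : ∀ a → a ∧ 𝟏 ≡ a
  ∧-identityʳ = 𝟏-greatest

  ⋀-empty : (f : ⊥ → Carrier) → ⋀ f ≡ 𝟏
  ⋀-empty f = ≤-antisym (𝟏-greatest (⋀ f)) (⋀-greatest f 𝟏 (λ ()))

  ⋁-unit : (f : ⊤ → Carrier) → ⋁ f ≡ f tt
  ⋁-unit f = ≤-antisym (⋁-least f (f tt) (λ _ → ≤-refl (f tt))) (⋁-upper f tt)

module DesignatedProperties (𝔸 : DesignatedCobounded) where
  open DesignatedCobounded 𝔸
  open CoboundedProperties algebra
  open Semantics 𝔸
  open ≡-Reasoning

  ∅ : V Carrier
  ∅ = mk ⊥ (λ ()) (λ ())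

  ⁅_↦_⁆ : V Carrier → Carrier → V Carrier
  ⁅ x ↦ d ⁆ = mk ⊤ (λ _ → x) (λ _ → d)

  ⟦∅≐∅⟧≡𝟏 : ⟦ ∅ ≐ ∅ ⟧ ≡ 𝟏
  ⟦∅≐∅⟧≡𝟏 = begin
    ⟦ ∅ ≐ ∅ ⟧  ≡⟨ cong₂ _∧_ (⋀-empty _) (⋀-empty _) ⟩
    𝟏 ∧ 𝟏      ≡⟨ ∧-identityʳ 𝟏 ⟩
    𝟏          ∎

  ⟦∈⁅↦⁆⟧ : ∀ u x d → ⟦ u ∈ ⁅ x ↦ d ⁆ ⟧ ≡ d ∧ ⟦ x ≐ u ⟧
  ⟦∈⁅↦⁆⟧ _ _ _ = ⋁-unit _

  ⟦∅∈⁅∅↦d⁆⟧≡d : ∀ d → ⟦ ∅ ∈ ⁅ ∅ ↦ d ⁆ ⟧ ≡ d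
  ⟦∅∈⁅∅↦d⁆⟧≡d d = begin
    ⟦ ∅ ∈ ⁅ ∅ ↦ d ⁆ ⟧  ≡⟨ ⟦∈⁅↦⁆⟧ ∅ ∅ d ⟩
    d ∧ ⟦ ∅ ≐ ∅ ⟧      ≡⟨ cong (d ∧_) ⟦∅≐∅⟧≡𝟏 ⟩
    d ∧ 𝟏              ≡⟨ ∧-identityʳ d ⟩
    d                  ∎

  ⊨*-of-⊭ : ⊨ 𝟏 → ∀ {a} → ¬ (⊨ a) → ⊨ (a *)
  ⊨*-of-⊭ ⊨𝟏 ⊭a = subst D (sym (*-out _ ⊭a)) ⊨𝟏

  ⊨*-of-⊨ : ∀ {a} → ⊨ a → a ≢ 𝟏 → ⊨ (a *)
  ⊨*-of-⊨ {a} ⊨a a≢𝟏 = subst D (sym (*-mid a ⊨a a≢𝟏)) ⊨a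

  ⊨∈-and-⊨∉ : ∀ {d} → ⊨ d → d ≢ 𝟏 → (⊨ ⟦ ∅ ∈ ⁅ ∅ ↦ d ⁆ ⟧) × (⊨ ⟦ ∅ ∉ ⁅ ∅ ↦ d ⁆ ⟧)
  ⊨∈-and-⊨∉ {d} ⊨d d≢𝟏 =
    subst (λ a → ⊨ a × ⊨ (a *)) (sym (⟦∅∈⁅∅↦d⁆⟧≡d d)) (⊨d , ⊨*-of-⊨ ⊨d d≢𝟏)

mainTheorem11 : (𝔸 : UltraDesignatedCobounded) →
    let open UltraDesignatedCobounded 𝔸
        open Semantics dc
    in ((u v : V Carrier) → ¬ (⊨ ⟦ u ∈ v ⟧) → ⊨ ⟦ u ∉ v ⟧)
       × ((∃ λ d → D d × ¬ (d ≡ 𝟏)) →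
          ∃ λ (u : V Carrier) → ∃ λ (v : V Carrier) → (⊨ ⟦ u ∈ v ⟧) × (⊨ ⟦ u ∉ v ⟧))
mainTheorem11 𝔸 =
  (λ u v → ⊨*-of-⊭ 𝟏∈D) ,
  λ { (d , Dd , d≢𝟏) → ∅ , ⁅ ∅ ↦ d ⁆ , ⊨∈-and-⊨∉ Dd d≢𝟏 }
  where
  open UltraDesignatedCobounded 𝔸 using (dc; ultra)
  open IsDesignated (IsUltraDesignated.designated ultra) using (𝟏∈D)
  open DesignatedProperties dc
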